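{- There is an effective method which, given a nullary predicate $p$ and a $\mathsf{MON}_=$ formula $F$, computes a formula $F'$ such that: (1) $F'$ is a $\mathsf{QMON}_=$ formula; (2) $F' \equiv \exists p\, F$; (3) $p$ is the only quantified predicate in $F'$; (4) all occurrences of $p$ in $F'$ are in positive occurrences of subformulas of the forms $\exists p\, p$ and $\exists p\, \lnot p$; (5) every free individual variable, every constant and every predicate occurring in $F'$ also occurs in $F$.
   Context: $\mathsf{MON}_=$ is the class of first-order formulas with equality whose predicates are nullary or unary, which may contain constants but no function symbols of positive arity, and which may contain free individual variables; $\mathsf{QMON}_=$ is $\mathsf{MON}_=$ extended by second-order quantification upon predicates. A subformula occurrence is positive if it lies within the scope of an even number of negations. $G \equiv H$ means same truth value in every interpretation under every assignment. -}

module Defs where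

open import Level using (0ℓ)
open import Data.Nat using (ℕ; _≟_)
open import Data.Bool using (Bool; T)
open import Data.Unit using (⊤)
open import Data.Empty using (⊥)
open import Data.Product using (Σ; _×_)
open import Data.Sum using (_⊎_)
open import Relation.Nullary using (¬_; yes; no)
open import Relation.Binary.PropositionalEquality using (_≡_; _≢_)

-- Syntax of QMON_= (monadic first-order logic with equality, constants,
-- free individual variables, extended by second-order quantification
-- upon nullary and unary predicates).
--
-- Individual variables, constants, nullary predicates and unary
-- predicates are each named by natural numbers (four disjoint
-- namespaces; a nullary and a unary predicate are different symbols
-- even if they carry the same number).

data Term : Set where
  var : ℕ → Term
  con : ℕ → Term

data Form : Set where
  tt ff    : Form
  nul      : ℕ → Form
  una      : ℕ → Term → Form
  _≐_      : Term → Term → Form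
  ¬'_      : Form → Form
  _∧'_ _∨'_ : Form → Form → Form
  ∃ᵢ ∀ᵢ    : ℕ → Form → Form
  ∃₀ ∀₀    : ℕ → Form → Form
  ∃₁ ∀₁    : ℕ → Form → Form

data IsMON : Form → Set where
  tt  : IsMON tt
  ff  : IsMON ff
  nul : ∀ n → IsMON (nul n)
  una : ∀ n t → IsMON (una n t)
  eq  : ∀ t u → IsMON (t ≐ u)
  neg : ∀ {F} → IsMON F → IsMON (¬' F)
  and : ∀ {F G} → IsMON F → IsMON G → IsMON (F ∧' G)
  or  : ∀ {F G} → IsMON F → IsMON G → IsMON (F ∨' G)
  ex  : ∀ {F} x → IsMON F → IsMON (∃ᵢ x F)
  all : ∀ {F} x → IsMON F → IsMON (∀ᵢ x F)

record Structure : Set₁ where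
  field
    D    : Set
    d₀   : D                      -- domains are nonempty
    Icon : ℕ → D
    Inul : ℕ → Bool
    Iuna : ℕ → D → Bool

open Structure

update : {A : Set} → (ℕ → A) → ℕ → A → (ℕ → A)
update f x a y with y ≟ x
... | yes _ = a
... | no  _ = f y

evalT : (M : Structure) → (ℕ → D M) → Term → D M
evalT M σ (var x) = σ x
evalT M σ (con c) = Icon M c

⟦_⟧ : Form → (M : Structure) → (ℕ → D M) → Set
⟦ tt ⟧ M σ = ⊤
⟦ ff ⟧ M σ = ⊥
⟦ nul n ⟧ M σ = T (Inul M n)
⟦ una n t ⟧ M σ = T (Iuna M n (evalT M σ t))
⟦ t ≐ u ⟧ M σ = evalT M σ t ≡ evalT M σ u
⟦ ¬' F ⟧ M σ = ¬ ⟦ F ⟧ M σ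
⟦ F ∧' G ⟧ M σ = ⟦ F ⟧ M σ × ⟦ G ⟧ M σ
⟦ F ∨' G ⟧ M σ = ⟦ F ⟧ M σ ⊎ ⟦ G ⟧ M σ
⟦ ∃ᵢ x F ⟧ M σ = Σ (D M) λ d → ⟦ F ⟧ M (update σ x d)
⟦ ∀ᵢ x F ⟧ M σ = (d : D M) → ⟦ F ⟧ M (update σ x d)
⟦ ∃₀ p F ⟧ M σ = Σ Bool λ b → ⟦ F ⟧ (record M { Inul = update (Inul M) p b }) σ
⟦ ∀₀ p F ⟧ M σ = (b : Bool) → ⟦ F ⟧ (record M { Inul = update (Inul M) p b }) σ
⟦ ∃₁ q F ⟧ M σ = Σ (D M → Bool) λ P → ⟦ F ⟧ (record M { Iuna = update (Iuna M) q P }) σ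
⟦ ∀₁ q F ⟧ M σ = (P : D M → Bool) → ⟦ F ⟧ (record M { Iuna = update (Iuna M) q P }) σ

data OnlyQuantified (p : ℕ) : Form → Set where
  tt  : OnlyQuantified p tt
  ff  : OnlyQuantified p ff
  nul : ∀ n → OnlyQuantified p (nul n)
  una : ∀ n t → OnlyQuantified p (una n t)
  eq  : ∀ t u → OnlyQuantified p (t ≐ u)
  neg : ∀ {F} → OnlyQuantified p F → OnlyQuantified p (¬' F)
  and : ∀ {F G} → OnlyQuantified p F → OnlyQuantified p G → OnlyQuantified p (F ∧' G)
  or  : ∀ {F G} → OnlyQuantified p F → OnlyQuantified p G → OnlyQuantified p (F ∨' G)
  ex  : ∀ {F} x → OnlyQuantified p F → OnlyQuantified p (∃ᵢ x F)
  all : ∀ {F} x → OnlyQuantified p F → OnlyQuantified p (∀ᵢ x F)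
  ex₀  : ∀ {F} → OnlyQuantified p F → OnlyQuantified p (∃₀ p F)
  all₀ : ∀ {F} → OnlyQuantified p F → OnlyQuantified p (∀₀ p F)

-- Condition (4): every occurrence of the nullary predicate p in F lies
-- within a positive occurrence (even number of enclosing negations) of a
-- subformula of the form  ∃p p  or  ∃p ¬p.

data Polarity : Set where
  pos neg : Polarity

flip : Polarity → Polarity
flip pos = neg
flip neg = pos

data PInPosMarkers (p : ℕ) : Polarity → Form → Set where
  mark-p  : PInPosMarkers p pos (∃₀ p (nul p))
  mark-¬p : PInPosMarkers p pos (∃₀ p (¬' (nul p)))
  tt  : ∀ {s} → PInPosMarkers p s tt
  ff  : ∀ {s} → PInPosMarkers p s ff
  nul : ∀ {s} n → n ≢ p → PInPosMarkers p s (nul n)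
  una : ∀ {s} n t → PInPosMarkers p s (una n t)
  eq  : ∀ {s} t u → PInPosMarkers p s (t ≐ u)
  neg : ∀ {s F} → PInPosMarkers p (flip s) F → PInPosMarkers p s (¬' F)
  and : ∀ {s F G} → PInPosMarkers p s F → PInPosMarkers p s G → PInPosMarkers p s (F ∧' G)
  or  : ∀ {s F G} → PInPosMarkers p s F → PInPosMarkers p s G → PInPosMarkers p s (F ∨' G)
  ex  : ∀ {s F} x → PInPosMarkers p s F → PInPosMarkers p s (∃ᵢ x F)
  all : ∀ {s F} x → PInPosMarkers p s F → PInPosMarkers p s (∀ᵢ x F)
  ex₀  : ∀ {s F} q → q ≢ p → PInPosMarkers p s F → PInPosMarkers p s (∃₀ q F)
  all₀ : ∀ {s F} q → q ≢ p → PInPosMarkers p s F → PInPosMarkers p s (∀₀ q F)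
  ex₁  : ∀ {s F} q → PInPosMarkers p s F → PInPosMarkers p s (∃₁ q F)
  all₁ : ∀ {s F} q → PInPosMarkers p s F → PInPosMarkers p s (∀₁ q F)

data VarInTerm (x : ℕ) : Term → Set where
  here : VarInTerm x (var x)

data ConInTerm (c : ℕ) : Term → Set where
  here : ConInTerm c (con c)

data FreeVar (x : ℕ) : Form → Set where
  una  : ∀ {n t} → VarInTerm x t → FreeVar x (una n t)
  eqˡ  : ∀ {t u} → VarInTerm x t → FreeVar x (t ≐ u)
  eqʳ  : ∀ {t u} → VarInTerm x u → FreeVar x (t ≐ u)
  neg  : ∀ {F} → FreeVar x F → FreeVar x (¬' F)
  andˡ : ∀ {F G} → FreeVar x F → FreeVar x (F ∧' G)
  andʳ : ∀ {F G} → FreeVar x G → FreeVar x (F ∧' G)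
  orˡ  : ∀ {F G} → FreeVar x F → FreeVar x (F ∨' G)
  orʳ  : ∀ {F G} → FreeVar x G → FreeVar x (F ∨' G)
  ex   : ∀ {y F} → y ≢ x → FreeVar x F → FreeVar x (∃ᵢ y F)
  all  : ∀ {y F} → y ≢ x → FreeVar x F → FreeVar x (∀ᵢ y F)
  ex₀  : ∀ {q F} → FreeVar x F → FreeVar x (∃₀ q F)
  all₀ : ∀ {q F} → FreeVar x F → FreeVar x (∀₀ q F)
  ex₁  : ∀ {q F} → FreeVar x F → FreeVar x (∃₁ q F)
  all₁ : ∀ {q F} → FreeVar x F → FreeVar x (∀₁ q F)

data ConOcc (c : ℕ) : Form → Set where
  una  : ∀ {n t} → ConInTerm c t → ConOcc c (una n t)
  eqˡ  : ∀ {t u} → ConInTerm c t → ConOcc c (t ≐ u)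
  eqʳ  : ∀ {t u} → ConInTerm c u → ConOcc c (t ≐ u)
  neg  : ∀ {F} → ConOcc c F → ConOcc c (¬' F)
  andˡ : ∀ {F G} → ConOcc c F → ConOcc c (F ∧' G)
  andʳ : ∀ {F G} → ConOcc c G → ConOcc c (F ∧' G)
  orˡ  : ∀ {F G} → ConOcc c F → ConOcc c (F ∨' G)
  orʳ  : ∀ {F G} → ConOcc c G → ConOcc c (F ∨' G)
  ex   : ∀ {y F} → ConOcc c F → ConOcc c (∃ᵢ y F)
  all  : ∀ {y F} → ConOcc c F → ConOcc c (∀ᵢ y F)
  ex₀  : ∀ {q F} → ConOcc c F → ConOcc c (∃₀ q F)
  all₀ : ∀ {q F} → ConOcc c F → ConOcc c (∀₀ q F)
  ex₁  : ∀ {q F} → ConOcc c F → ConOcc c (∃₁ q F)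
  all₁ : ∀ {q F} → ConOcc c F → ConOcc c (∀₁ q F)

data NulOcc (q : ℕ) : Form → Set where
  atom  : NulOcc q (nul q)
  neg   : ∀ {F} → NulOcc q F → NulOcc q (¬' F)
  andˡ  : ∀ {F G} → NulOcc q F → NulOcc q (F ∧' G)
  andʳ  : ∀ {F G} → NulOcc q G → NulOcc q (F ∧' G)
  orˡ   : ∀ {F G} → NulOcc q F → NulOcc q (F ∨' G)
  orʳ   : ∀ {F G} → NulOcc q G → NulOcc q (F ∨' G)
  ex    : ∀ {y F} → NulOcc q F → NulOcc q (∃ᵢ y F)
  all   : ∀ {y F} → NulOcc q F → NulOcc q (∀ᵢ y F)
  bex₀  : ∀ {F} → NulOcc q (∃₀ q F)
  ball₀ : ∀ {F} → NulOcc q (∀₀ q F)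
  ex₀   : ∀ {r F} → NulOcc q F → NulOcc q (∃₀ r F)
  all₀  : ∀ {r F} → NulOcc q F → NulOcc q (∀₀ r F)
  ex₁   : ∀ {r F} → NulOcc q F → NulOcc q (∃₁ r F)
  all₁  : ∀ {r F} → NulOcc q F → NulOcc q (∀₁ r F)

data UnaOcc (q : ℕ) : Form → Set where
  atom  : ∀ {t} → UnaOcc q (una q t)
  neg   : ∀ {F} → UnaOcc q F → UnaOcc q (¬' F)
  andˡ  : ∀ {F G} → UnaOcc q F → UnaOcc q (F ∧' G)
  andʳ  : ∀ {F G} → UnaOcc q G → UnaOcc q (F ∧' G)
  orˡ   : ∀ {F G} → UnaOcc q F → UnaOcc q (F ∨' G)
  orʳ   : ∀ {F G} → UnaOcc q G → UnaOcc q (F ∨' G)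
  ex    : ∀ {y F} → UnaOcc q F → UnaOcc q (∃ᵢ y F)
  all   : ∀ {y F} → UnaOcc q F → UnaOcc q (∀ᵢ y F)
  bex₁  : ∀ {F} → UnaOcc q (∃₁ q F)
  ball₁ : ∀ {F} → UnaOcc q (∀₁ q F)
  ex₀   : ∀ {r F} → UnaOcc q F → UnaOcc q (∃₀ r F)
  all₀  : ∀ {r F} → UnaOcc q F → UnaOcc q (∀₀ r F)
  ex₁   : ∀ {r F} → UnaOcc q F → UnaOcc q (∃₁ r F)
  all₁  : ∀ {r F} → UnaOcc q F → UnaOcc q (∀₁ r F)

SymbolsAmong : Form → Form → Set
SymbolsAmong G F =
  (∀ x → FreeVar x G → FreeVar x F) ×
  (∀ c → ConOcc c G → ConOcc c F) ×
  (∀ q → NulOcc q G → NulOcc q F) ×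
  (∀ q → UnaOcc q G → UnaOcc q F)

-- For first-order F, ∃p F is equivalent to its Shannon expansion
-- F[⊤/p] ∨ F[⊥/p]. This
-- disjunction contains neither p nor any second-order quantifier, so the
-- conditions on p hold vacuously, and substituting closed truth constants
-- for p introduces no new symbols.
module Submission where

open import Defs
open import Level using (0ℓ)
open import Data.Nat using (ℕ; _≟_)
open import Data.Bool using (Bool; true; false)
open import Data.Empty using (⊥-elim)
open import Data.Product using (Σ; _×_; _,_)
open import Data.Product.Function.NonDependent.Propositional using (_×-⇔_)
open import Data.Product.Function.Dependent.Propositional using (Σ-⇔)
open import Data.Sum using (_⊎_; inj₁; inj₂)
open import Data.Sum.Function.Propositional using (_⊎-⇔_)
open import Function.Bundles using (_⇔_; mk⇔; module Equivalence)
open import Function.Construct.Identity using (⇔-id; ↠-id)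
open import Function.Construct.Symmetry using (⇔-sym)
open import Function.Construct.Composition using (_⇔-∘_)
open import Function.Related.TypeIsomorphisms using (¬-cong-⇔)
open import Relation.Nullary using (¬_; yes; no)
open import Relation.Binary.PropositionalEquality using (refl)
open import Axiom.ExcludedMiddle using (ExcludedMiddle)
open Structure
open Equivalence using (to; from)

Π-⇔ : {A : Set} {B C : A → Set} →
      (∀ a → B a ⇔ C a) → ((a : A) → B a) ⇔ ((a : A) → C a)
Π-⇔ B⇔C = mk⇔ (λ f a → to (B⇔C a) (f a)) (λ g a → from (B⇔C a) (g a))

Σ-Bool⇔⊎ : {P : Bool → Set} → Σ Bool P ⇔ (P true ⊎ P false)
Σ-Bool⇔⊎ = mk⇔ (λ { (true , x) → inj₁ x ; (false , x) → inj₂ x })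
               (λ { (inj₁ x) → true , x ; (inj₂ x) → false , x })

⌜_⌝ : Bool → Form
⌜ true ⌝  = tt
⌜ false ⌝ = ff

infixl 30 _[_/_]

_[_/_] : Form → Bool → ℕ → Form
tt [ b / p ] = tt
ff [ b / p ] = ff
nul n [ b / p ] with n ≟ p
... | yes _ = ⌜ b ⌝
... | no  _ = nul n
una n t [ b / p ] = una n t
(t ≐ u) [ b / p ] = t ≐ u
(¬' F) [ b / p ] = ¬' F [ b / p ]
(F ∧' G) [ b / p ] = F [ b / p ] ∧' G [ b / p ]
(F ∨' G) [ b / p ] = F [ b / p ] ∨' G [ b / p ]
∃ᵢ x F [ b / p ] = ∃ᵢ x (F [ b / p ])
∀ᵢ x F [ b / p ] = ∀ᵢ x (F [ b / p ])
∃₀ q F [ b / p ] with q ≟ p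
... | yes _ = ∃₀ q F
... | no  _ = ∃₀ q (F [ b / p ])
∀₀ q F [ b / p ] with q ≟ p
... | yes _ = ∀₀ q F
... | no  _ = ∀₀ q (F [ b / p ])
∃₁ q F [ b / p ] = ∃₁ q (F [ b / p ])
∀₁ q F [ b / p ] = ∀₁ q (F [ b / p ])

shannon : ℕ → Form → Form
shannon p F = F [ true / p ] ∨' F [ false / p ]

_⟨_≔_⟩ : Structure → ℕ → Bool → Structure
M ⟨ p ≔ b ⟩ = record M { Inul = update (Inul M) p b }

[/]-sound : ∀ {F} → IsMON F → ∀ p b M σ →
            ⟦ F [ b / p ] ⟧ M σ ⇔ ⟦ F ⟧ (M ⟨ p ≔ b ⟩) σ
[/]-sound tt p b M σ = ⇔-id _
[/]-sound ff p b M σ = ⇔-id _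
[/]-sound (nul n) p b M σ with n ≟ p | b
... | yes _ | true  = ⇔-id _
... | yes _ | false = ⇔-id _
... | no  _ | _     = ⇔-id _
-- evalT is stuck on an abstract term, so terms are split for both sides to reduce.
[/]-sound (una n (var x)) p b M σ = ⇔-id _
[/]-sound (una n (con c)) p b M σ = ⇔-id _
[/]-sound (eq (var x) (var y)) p b M σ = ⇔-id _
[/]-sound (eq (var x) (con c)) p b M σ = ⇔-id _
[/]-sound (eq (con c) (var x)) p b M σ = ⇔-id _
[/]-sound (eq (con c) (con d)) p b M σ = ⇔-id _
[/]-sound (neg F) p b M σ = ¬-cong-⇔ ([/]-sound F p b M σ)
[/]-sound (and F G) p b M σ = [/]-sound F p b M σ ×-⇔ [/]-sound G p b M σ
[/]-sound (or F G) p b M σ = [/]-sound F p b M σ ⊎-⇔ [/]-sound G p b M σ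
[/]-sound (ex x F) p b M σ = Σ-⇔ (↠-id _) λ {d} → [/]-sound F p b M (update σ x d)
[/]-sound (all x F) p b M σ = Π-⇔ λ d → [/]-sound F p b M (update σ x d)

shannon-sound : ∀ {F} → IsMON F → ∀ p M σ →
                ⟦ shannon p F ⟧ M σ ⇔ ⟦ ∃₀ p F ⟧ M σ
shannon-sound F p M σ =
  ⇔-sym Σ-Bool⇔⊎ ⇔-∘ ([/]-sound F p true M σ ⊎-⇔ [/]-sound F p false M σ)

IsMON-⌜⌝ : ∀ b → IsMON ⌜ b ⌝
IsMON-⌜⌝ true  = tt
IsMON-⌜⌝ false = ff

IsMON-[/] : ∀ {F} → IsMON F → ∀ b p → IsMON (F [ b / p ])
IsMON-[/] tt b p = tt
IsMON-[/] ff b p = ff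
IsMON-[/] (nul n) b p with n ≟ p
... | yes _ = IsMON-⌜⌝ b
... | no  _ = nul n
IsMON-[/] (una n t) b p = una n t
IsMON-[/] (eq t u) b p = eq t u
IsMON-[/] (neg F) b p = neg (IsMON-[/] F b p)
IsMON-[/] (and F G) b p = and (IsMON-[/] F b p) (IsMON-[/] G b p)
IsMON-[/] (or F G) b p = or (IsMON-[/] F b p) (IsMON-[/] G b p)
IsMON-[/] (ex x F) b p = ex x (IsMON-[/] F b p)
IsMON-[/] (all x F) b p = all x (IsMON-[/] F b p)

IsMON⇒OnlyQuantified : ∀ {F} → IsMON F → ∀ p → OnlyQuantified p F
IsMON⇒OnlyQuantified tt p = tt
IsMON⇒OnlyQuantified ff p = ff
IsMON⇒OnlyQuantified (nul n) p = nul n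
IsMON⇒OnlyQuantified (una n t) p = una n t
IsMON⇒OnlyQuantified (eq t u) p = eq t u
IsMON⇒OnlyQuantified (neg F) p = neg (IsMON⇒OnlyQuantified F p)
IsMON⇒OnlyQuantified (and F G) p = and (IsMON⇒OnlyQuantified F p) (IsMON⇒OnlyQuantified G p)
IsMON⇒OnlyQuantified (or F G) p = or (IsMON⇒OnlyQuantified F p) (IsMON⇒OnlyQuantified G p)
IsMON⇒OnlyQuantified (ex x F) p = ex x (IsMON⇒OnlyQuantified F p)
IsMON⇒OnlyQuantified (all x F) p = all x (IsMON⇒OnlyQuantified F p)

p∉⌜⌝ : ∀ p b → ¬ NulOcc p ⌜ b ⌝
p∉⌜⌝ p true  ()
p∉⌜⌝ p false ()

p∉F[b/p] : ∀ {F} → IsMON F → ∀ b p → ¬ NulOcc p (F [ b / p ])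
p∉F[b/p] (nul n) b p o with n ≟ p | o
... | yes _   | o′   = p∉⌜⌝ p b o′
... | no  n≢p | atom = n≢p refl
p∉F[b/p] (neg F) b p (neg o) = p∉F[b/p] F b p o
p∉F[b/p] (and F G) b p (andˡ o) = p∉F[b/p] F b p o
p∉F[b/p] (and F G) b p (andʳ o) = p∉F[b/p] G b p o
p∉F[b/p] (or F G) b p (orˡ o) = p∉F[b/p] F b p o
p∉F[b/p] (or F G) b p (orʳ o) = p∉F[b/p] G b p o
p∉F[b/p] (ex x F) b p (ex o) = p∉F[b/p] F b p o
p∉F[b/p] (all x F) b p (all o) = p∉F[b/p] F b p o

p∉⇒PInPosMarkers : ∀ {p} F → ¬ NulOcc p F → ∀ s → PInPosMarkers p s F
p∉⇒PInPosMarkers tt p∉ s = tt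
p∉⇒PInPosMarkers ff p∉ s = ff
p∉⇒PInPosMarkers {p} (nul n) p∉ s with n ≟ p
... | yes refl = ⊥-elim (p∉ atom)
... | no  n≢p  = nul n n≢p
p∉⇒PInPosMarkers (una n t) p∉ s = una n t
p∉⇒PInPosMarkers (t ≐ u) p∉ s = eq t u
p∉⇒PInPosMarkers (¬' F) p∉ s = neg (p∉⇒PInPosMarkers F (λ o → p∉ (neg o)) (flip s))
p∉⇒PInPosMarkers (F ∧' G) p∉ s =
  and (p∉⇒PInPosMarkers F (λ o → p∉ (andˡ o)) s) (p∉⇒PInPosMarkers G (λ o → p∉ (andʳ o)) s)
p∉⇒PInPosMarkers (F ∨' G) p∉ s =
  or (p∉⇒PInPosMarkers F (λ o → p∉ (orˡ o)) s) (p∉⇒PInPosMarkers G (λ o → p∉ (orʳ o)) s)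
p∉⇒PInPosMarkers (∃ᵢ x F) p∉ s = ex x (p∉⇒PInPosMarkers F (λ o → p∉ (ex o)) s)
p∉⇒PInPosMarkers (∀ᵢ x F) p∉ s = all x (p∉⇒PInPosMarkers F (λ o → p∉ (all o)) s)
p∉⇒PInPosMarkers {p} (∃₀ q F) p∉ s with q ≟ p
... | yes refl = ⊥-elim (p∉ bex₀)
... | no  q≢p  = ex₀ q q≢p (p∉⇒PInPosMarkers F (λ o → p∉ (ex₀ o)) s)
p∉⇒PInPosMarkers {p} (∀₀ q F) p∉ s with q ≟ p
... | yes refl = ⊥-elim (p∉ ball₀)
... | no  q≢p  = all₀ q q≢p (p∉⇒PInPosMarkers F (λ o → p∉ (all₀ o)) s)
p∉⇒PInPosMarkers (∃₁ q F) p∉ s = ex₁ q (p∉⇒PInPosMarkers F (λ o → p∉ (ex₁ o)) s)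
p∉⇒PInPosMarkers (∀₁ q F) p∉ s = all₁ q (p∉⇒PInPosMarkers F (λ o → p∉ (all₁ o)) s)

infix 4 _⊑_

_⊑_ : Form → Form → Set
G ⊑ F = SymbolsAmong G F

⊑-refl : ∀ {F} → F ⊑ F
⊑-refl = (λ _ o → o) , (λ _ o → o) , (λ _ o → o) , (λ _ o → o)

⌜⌝-⊑ : ∀ b {F} → ⌜ b ⌝ ⊑ F
⌜⌝-⊑ true  = (λ _ ()) , (λ _ ()) , (λ _ ()) , (λ _ ())
⌜⌝-⊑ false = (λ _ ()) , (λ _ ()) , (λ _ ()) , (λ _ ())

∨'-lub-⊑ : ∀ {F G H} → G ⊑ F → H ⊑ F → G ∨' H ⊑ F
∨'-lub-⊑ (v , c , n , u) (v′ , c′ , n′ , u′) =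
  (λ { x (orˡ o) → v x o ; x (orʳ o) → v′ x o }) ,
  (λ { x (orˡ o) → c x o ; x (orʳ o) → c′ x o }) ,
  (λ { x (orˡ o) → n x o ; x (orʳ o) → n′ x o }) ,
  (λ { x (orˡ o) → u x o ; x (orʳ o) → u′ x o })

¬'-mono-⊑ : ∀ {F G} → G ⊑ F → ¬' G ⊑ ¬' F
¬'-mono-⊑ (v , c , n , u) =
  (λ { x (neg o) → neg (v x o) }) , (λ { x (neg o) → neg (c x o) }) ,
  (λ { x (neg o) → neg (n x o) }) , (λ { x (neg o) → neg (u x o) })

∧'-mono-⊑ : ∀ {F F′ G G′} → G ⊑ F → G′ ⊑ F′ → G ∧' G′ ⊑ F ∧' F′
∧'-mono-⊑ (v , c , n , u) (v′ , c′ , n′ , u′) =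
  (λ { x (andˡ o) → andˡ (v x o) ; x (andʳ o) → andʳ (v′ x o) }) ,
  (λ { x (andˡ o) → andˡ (c x o) ; x (andʳ o) → andʳ (c′ x o) }) ,
  (λ { x (andˡ o) → andˡ (n x o) ; x (andʳ o) → andʳ (n′ x o) }) ,
  (λ { x (andˡ o) → andˡ (u x o) ; x (andʳ o) → andʳ (u′ x o) })

∨'-mono-⊑ : ∀ {F F′ G G′} → G ⊑ F → G′ ⊑ F′ → G ∨' G′ ⊑ F ∨' F′
∨'-mono-⊑ (v , c , n , u) (v′ , c′ , n′ , u′) =
  (λ { x (orˡ o) → orˡ (v x o) ; x (orʳ o) → orʳ (v′ x o) }) ,
  (λ { x (orˡ o) → orˡ (c x o) ; x (orʳ o) → orʳ (c′ x o) }) ,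
  (λ { x (orˡ o) → orˡ (n x o) ; x (orʳ o) → orʳ (n′ x o) }) ,
  (λ { x (orˡ o) → orˡ (u x o) ; x (orʳ o) → orʳ (u′ x o) })

∃ᵢ-mono-⊑ : ∀ {F G} y → G ⊑ F → ∃ᵢ y G ⊑ ∃ᵢ y F
∃ᵢ-mono-⊑ y (v , c , n , u) =
  (λ { x (ex y≢x o) → ex y≢x (v x o) }) , (λ { x (ex o) → ex (c x o) }) ,
  (λ { x (ex o) → ex (n x o) }) , (λ { x (ex o) → ex (u x o) })

∀ᵢ-mono-⊑ : ∀ {F G} y → G ⊑ F → ∀ᵢ y G ⊑ ∀ᵢ y F
∀ᵢ-mono-⊑ y (v , c , n , u) =
  (λ { x (all y≢x o) → all y≢x (v x o) }) , (λ { x (all o) → all (c x o) }) ,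
  (λ { x (all o) → all (n x o) }) , (λ { x (all o) → all (u x o) })

∃₀-mono-⊑ : ∀ {F G} q → G ⊑ F → ∃₀ q G ⊑ ∃₀ q F
∃₀-mono-⊑ q (v , c , n , u) =
  (λ { x (ex₀ o) → ex₀ (v x o) }) , (λ { x (ex₀ o) → ex₀ (c x o) }) ,
  (λ { x bex₀ → bex₀ ; x (ex₀ o) → ex₀ (n x o) }) , (λ { x (ex₀ o) → ex₀ (u x o) })

∀₀-mono-⊑ : ∀ {F G} q → G ⊑ F → ∀₀ q G ⊑ ∀₀ q F
∀₀-mono-⊑ q (v , c , n , u) =
  (λ { x (all₀ o) → all₀ (v x o) }) , (λ { x (all₀ o) → all₀ (c x o) }) ,
  (λ { x ball₀ → ball₀ ; x (all₀ o) → all₀ (n x o) }) , (λ { x (all₀ o) → all₀ (u x o) })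

∃₁-mono-⊑ : ∀ {F G} q → G ⊑ F → ∃₁ q G ⊑ ∃₁ q F
∃₁-mono-⊑ q (v , c , n , u) =
  (λ { x (ex₁ o) → ex₁ (v x o) }) , (λ { x (ex₁ o) → ex₁ (c x o) }) ,
  (λ { x (ex₁ o) → ex₁ (n x o) }) , (λ { x bex₁ → bex₁ ; x (ex₁ o) → ex₁ (u x o) })

∀₁-mono-⊑ : ∀ {F G} q → G ⊑ F → ∀₁ q G ⊑ ∀₁ q F
∀₁-mono-⊑ q (v , c , n , u) =
  (λ { x (all₁ o) → all₁ (v x o) }) , (λ { x (all₁ o) → all₁ (c x o) }) ,
  (λ { x (all₁ o) → all₁ (n x o) }) , (λ { x ball₁ → ball₁ ; x (all₁ o) → all₁ (u x o) })

[/]-⊑ : ∀ F b p → F [ b / p ] ⊑ F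
[/]-⊑ tt b p = ⊑-refl
[/]-⊑ ff b p = ⊑-refl
[/]-⊑ (nul n) b p with n ≟ p
... | yes _ = ⌜⌝-⊑ b
... | no  _ = ⊑-refl
[/]-⊑ (una n t) b p = ⊑-refl
[/]-⊑ (t ≐ u) b p = ⊑-refl
[/]-⊑ (¬' F) b p = ¬'-mono-⊑ ([/]-⊑ F b p)
[/]-⊑ (F ∧' G) b p = ∧'-mono-⊑ ([/]-⊑ F b p) ([/]-⊑ G b p)
[/]-⊑ (F ∨' G) b p = ∨'-mono-⊑ ([/]-⊑ F b p) ([/]-⊑ G b p)
[/]-⊑ (∃ᵢ x F) b p = ∃ᵢ-mono-⊑ x ([/]-⊑ F b p)
[/]-⊑ (∀ᵢ x F) b p = ∀ᵢ-mono-⊑ x ([/]-⊑ F b p)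
[/]-⊑ (∃₀ q F) b p with q ≟ p
... | yes _ = ⊑-refl
... | no  _ = ∃₀-mono-⊑ q ([/]-⊑ F b p)
[/]-⊑ (∀₀ q F) b p with q ≟ p
... | yes _ = ⊑-refl
... | no  _ = ∀₀-mono-⊑ q ([/]-⊑ F b p)
[/]-⊑ (∃₁ q F) b p = ∃₁-mono-⊑ q ([/]-⊑ F b p)
[/]-⊑ (∀₁ q F) b p = ∀₁-mono-⊑ q ([/]-⊑ F b p)

IsMON-shannon : ∀ {F} → IsMON F → ∀ p → IsMON (shannon p F)
IsMON-shannon F p = or (IsMON-[/] F true p) (IsMON-[/] F false p)

p∉shannon : ∀ {F} → IsMON F → ∀ p → ¬ NulOcc p (shannon p F)
p∉shannon F p (orˡ o) = p∉F[b/p] F true p o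
p∉shannon F p (orʳ o) = p∉F[b/p] F false p o

shannon-⊑ : ∀ F p → shannon p F ⊑ F
shannon-⊑ F p = ∨'-lub-⊑ ([/]-⊑ F true p) ([/]-⊑ F false p)

lemma4 : Σ (ℕ → Form → Form) λ elim →
           (p : ℕ) (F : Form) → IsMON F →
           ((ExcludedMiddle 0ℓ → (M : Structure) (σ : ℕ → Structure.D M) →
               ⟦ elim p F ⟧ M σ ⇔ ⟦ ∃₀ p F ⟧ M σ)
            × OnlyQuantified p (elim p F)
            × PInPosMarkers p pos (elim p F)
            × SymbolsAmong (elim p F) F)
lemma4 = shannon , λ p F mon →
    (λ _ M σ → shannon-sound mon p M σ)
  , IsMON⇒OnlyQuantified (IsMON-shannon mon p) p
  , p∉⇒PInPosMarkers (shannon p F) (p∉shannon mon p) pos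
  , shannon-⊑ F p
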